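{- For every integer $n\ge 0$, there is exactly one Dumont permutation of the first kind of length $2n$ avoiding the pattern $321$, i.e. $|\mathfrak D^1_{2n}(321)|=1$.
   Context: A permutation $\sigma\in\mathfrak S_m$ contains a pattern $\tau\in\mathfrak S_k$ if $\sigma$ has a subsequence $(\sigma(i_1),\dots,\sigma(i_k))$, $i_1<\dots<i_k$, order-isomorphic to $\tau$; otherwise $\sigma$ avoids $\tau$. A Dumont permutation of the first kind of length $2n$ is a permutation $\pi\in\mathfrak S_{2n}$ such that for every $i$: if $\pi(i)$ is even then $i<2n$ and $\pi(i)>\pi(i+1)$; if $\pi(i)$ is odd then $i=2n$ or $\pi(i)<\pi(i+1)$. For $n=0$ the empty permutation is the unique such permutation. $\mathfrak D^1_{2n}(\tau)$ denotes the set of such permutations avoiding $\tau$. -}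

module Defs where

open import Data.Nat using (ℕ; zero; suc; _+_; _*_)
open import Data.Fin using (Fin; zero; suc; toℕ; _<_)
open import Data.Fin.Permutation using (Permutation′; _⟨$⟩ʳ_; permutation)
open import Data.Product using (Σ; ∃; _×_; _,_)
open import Data.Sum using (_⊎_)
open import Relation.Nullary using (¬_)
open import Relation.Binary.PropositionalEquality using (_≡_; refl)
open import Function.Bundles using (_⇔_)

IsEven : ℕ → Set
IsEven v = ∃ λ k → v ≡ k + k

IsOdd : ℕ → Set
IsOdd v = ∃ λ k → v ≡ suc (k + k)

-- Positions and values are 0-based internally: position i : Fin m stands for i+1,
-- and value π i : Fin m stands for the value toℕ (π i) + 1 in {1,…,m}.
val : ∀ {m} → Permutation′ m → Fin m → ℕ
val π i = suc (toℕ (π ⟨$⟩ʳ i))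

Contains : ∀ {m k} → Permutation′ m → Permutation′ k → Set
Contains {m} {k} σ τ =
  Σ (Fin k → Fin m) λ f →
    (∀ a b → a < b → f a < f b) ×
    (∀ a b → ((σ ⟨$⟩ʳ f a) < (σ ⟨$⟩ʳ f b)) ⇔ ((τ ⟨$⟩ʳ a) < (τ ⟨$⟩ʳ b)))

Avoids : ∀ {m k} → Permutation′ m → Permutation′ k → Set
Avoids σ τ = ¬ Contains σ τ

-- Dumont permutation of the first kind of length 2n (1-based values, positions):
-- if π(i) is even then i < 2n and π(i) > π(i+1);
-- if π(i) is odd then i = 2n or π(i) < π(i+1).
IsDumont1 : (n : ℕ) → Permutation′ (n + n) → Set
IsDumont1 n π =
  ∀ (i : Fin (n + n)) →
    (IsEven (val π i) →
       ∃ λ (j : Fin (n + n)) → (toℕ j ≡ suc (toℕ i)) × ((π ⟨$⟩ʳ j) < (π ⟨$⟩ʳ i)))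
  × (IsOdd (val π i) →
       (suc (toℕ i) ≡ n + n)
       ⊎ (∃ λ (j : Fin (n + n)) → (toℕ j ≡ suc (toℕ i)) × ((π ⟨$⟩ʳ i) < (π ⟨$⟩ʳ j))))

rev3 : Fin 3 → Fin 3
rev3 zero = suc (suc zero)
rev3 (suc zero) = suc zero
rev3 (suc (suc zero)) = zero

rev3-inv : ∀ x → rev3 (rev3 x) ≡ x
rev3-inv zero = refl
rev3-inv (suc zero) = refl
rev3-inv (suc (suc zero)) = refl

p321 : Permutation′ 3
p321 = permutation rev3 rev3 rev3-inv rev3-inv

InD1-321 : (n : ℕ) → Permutation′ (n + n) → Set
InD1-321 n π = IsDumont1 n π × Avoids π p321

{-# OPTIONS --safe #-}
module Submission where

-- The witness is 2 1 4 3 … 2n (2n−1). It moves every entry by at most one place, so it has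
-- no decreasing subsequence of length three; each even value 2q is followed by 2q−1, each odd
-- value 2q−1 by 2q+2 or by nothing.
-- Conversely, let σ be Dumont and 321-avoiding and agree with it on the first 2k positions, which
-- then carry exactly the values 1,…,2k. The value 2k+2 sits at a position p > 2k and, being even,
-- is followed by a smaller value, necessarily 2k+1. If p > 2k+1, the entry at position 2k+1
-- exceeds 2k+2 and forms a 321 with the entries at p and p+1; so p = 2k+1, and σ agrees with the
-- permutation on the first 2k+2 positions.

open import Defs
open import Data.Empty using (⊥-elim)
open import Data.Fin as Fin using (Fin; toℕ; fromℕ<; zero; suc)
open import Data.Fin.Patterns using (0F; 1F; 2F)
open import Data.Fin.Permutation using (Permutation′; _⟨$⟩ʳ_; _⟨$⟩ˡ_; permutation; inverseʳ)
open import Data.Fin.Properties as Finₚ using (toℕ-injective; toℕ-fromℕ<; toℕ<n)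
open import Data.Nat using (ℕ; zero; suc; _+_; _≤_; _<_; z≤n; s≤s)
open import Data.Nat.Properties
open import Data.Product using (∃; _×_; _,_; proj₁; proj₂)
open import Data.Sum using (_⊎_; inj₁; inj₂)
open import Function using (_∘_; _⇔_; mk⇔; module Equivalence; Injection)
open import Function.Properties.Equivalence as ⇔ using ()
open import Function.Properties.Inverse using (↔⇒↣)
open import Relation.Binary using (tri<; tri≈; tri>)
open import Relation.Binary.PropositionalEquality
  using (_≡_; _≢_; refl; sym; trans; cong; subst; module ≡-Reasoning)
open import Relation.Nullary using (¬_; yes; no)

even⇒suc-odd : ∀ {x} → IsEven x → IsOdd (suc x)
even⇒suc-odd (q , x≡q+q) = q , cong suc x≡q+q

odd⇒suc-even : ∀ {x} → IsOdd x → IsEven (suc x)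
odd⇒suc-even (q , x≡1+q+q) = suc q , cong suc (trans x≡1+q+q (sym (+-suc q q)))

suc-even⇒odd : ∀ {x} → IsEven (suc x) → IsOdd x
suc-even⇒odd (zero , ())
suc-even⇒odd (suc q , 1+x≡) = q , trans (suc-injective 1+x≡) (+-suc q q)

suc-odd⇒even : ∀ {x} → IsOdd (suc x) → IsEven x
suc-odd⇒even (q , 1+x≡) = q , suc-injective 1+x≡

even⊎odd : ∀ x → IsEven x ⊎ IsOdd x
even⊎odd zero = inj₁ (zero , refl)
even⊎odd (suc x) with even⊎odd x
... | inj₁ even = inj₂ (even⇒suc-odd even)
... | inj₂ odd = inj₁ (odd⇒suc-even odd)

even⇒¬odd : ∀ {x} → IsEven x → ¬ IsOdd x
even⇒¬odd {zero} _ (_ , ())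
even⇒¬odd {suc x} even odd = even⇒¬odd (suc-odd⇒even odd) (suc-even⇒odd even)

even<double⇒suc<double : ∀ {x} n → IsEven x → x < n + n → suc x < n + n
even<double⇒suc<double n even x<2n =
  ≤∧≢⇒< x<2n (λ 1+x≡2n → even⇒¬odd (n , refl) (subst IsOdd 1+x≡2n (even⇒suc-odd even)))

swapPairs : ∀ {m} → Fin m → Fin m
swapPairs {suc zero} zero = zero
swapPairs {suc (suc m)} 0F = 1F
swapPairs {suc (suc m)} 1F = 0F
swapPairs {suc (suc m)} (suc (suc i)) = suc (suc (swapPairs i))

swapPairs-involutive : ∀ {m} (i : Fin m) → swapPairs (swapPairs i) ≡ i
swapPairs-involutive {suc zero} zero = refl
swapPairs-involutive {suc (suc m)} 0F = refl
swapPairs-involutive {suc (suc m)} 1F = refl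
swapPairs-involutive {suc (suc m)} (suc (suc i)) = cong (λ j → suc (suc j)) (swapPairs-involutive i)

toℕ-swapPairs-≤ : ∀ {m} (i : Fin m) → toℕ (swapPairs i) ≤ suc (toℕ i)
toℕ-swapPairs-≤ {suc zero} zero = z≤n
toℕ-swapPairs-≤ {suc (suc m)} 0F = s≤s z≤n
toℕ-swapPairs-≤ {suc (suc m)} 1F = z≤n
toℕ-swapPairs-≤ {suc (suc m)} (suc (suc i)) = s≤s (s≤s (toℕ-swapPairs-≤ i))

toℕ-swapPairs-≥ : ∀ {m} (i : Fin m) → toℕ i ≤ suc (toℕ (swapPairs i))
toℕ-swapPairs-≥ i = subst (λ j → toℕ j ≤ suc (toℕ (swapPairs i))) (swapPairs-involutive i)
                          (toℕ-swapPairs-≤ (swapPairs i))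

toℕ-swapPairs-even : ∀ {m} (i : Fin m) → IsEven (toℕ i) → suc (toℕ i) < m →
                     toℕ (swapPairs i) ≡ suc (toℕ i)
toℕ-swapPairs-even {suc zero} zero _ (s≤s ())
toℕ-swapPairs-even {suc (suc m)} 0F _ _ = refl
toℕ-swapPairs-even {suc (suc m)} 1F even _ = ⊥-elim (even⇒¬odd even (zero , refl))
toℕ-swapPairs-even {suc (suc m)} (suc (suc i)) even (s≤s (s≤s 3+i≤m)) =
  cong (λ j → suc (suc j)) (toℕ-swapPairs-even i (suc-odd⇒even (suc-even⇒odd even)) 3+i≤m)

toℕ-swapPairs-odd : ∀ {m} (i : Fin m) → IsOdd (toℕ i) → suc (toℕ (swapPairs i)) ≡ toℕ i
toℕ-swapPairs-odd {suc zero} zero (_ , ())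
toℕ-swapPairs-odd {suc (suc m)} 0F (_ , ())
toℕ-swapPairs-odd {suc (suc m)} 1F _ = refl
toℕ-swapPairs-odd {suc (suc m)} (suc (suc i)) odd =
  cong (λ j → suc (suc j)) (toℕ-swapPairs-odd i (suc-even⇒odd (suc-odd⇒even odd)))

toℕ-swapPairs-<double : ∀ {m} k (i : Fin m) → toℕ i < k + k → toℕ (swapPairs i) < k + k
toℕ-swapPairs-<double k i i<2k with m≤n⇒m<n∨m≡n i<2k
... | inj₁ 1+i<2k = ≤-<-trans (toℕ-swapPairs-≤ i) 1+i<2k
... | inj₂ 1+i≡2k = <-trans (≤-reflexive (toℕ-swapPairs-odd i (suc-even⇒odd (k , 1+i≡2k)))) i<2k

swapPairsPerm : ∀ {m} → Permutation′ m
swapPairsPerm = permutation swapPairs swapPairs swapPairs-involutive swapPairs-involutive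

record Occurrence321 {m} (σ : Permutation′ m) : Set where
  constructor occurrence
  field
    {i j k} : Fin m
    i<j : i Fin.< j
    j<k : j Fin.< k
    σk<σj : σ ⟨$⟩ʳ k Fin.< σ ⟨$⟩ʳ j
    σj<σi : σ ⟨$⟩ʳ j Fin.< σ ⟨$⟩ʳ i

Fin3-<-elim : ∀ (P : Fin 3 → Fin 3 → Set) → P 0F 1F → P 0F 2F → P 1F 2F → ∀ {x y} → x Fin.< y → P x y
Fin3-<-elim _ p01 _ _ {0F} {1F} _ = p01
Fin3-<-elim _ _ p02 _ {0F} {2F} _ = p02
Fin3-<-elim _ _ _ p12 {1F} {2F} _ = p12
Fin3-<-elim _ _ _ _ {_} {0F} ()
Fin3-<-elim _ _ _ _ {1F} {1F} (s≤s ())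
Fin3-<-elim _ _ _ _ {2F} {1F} (s≤s ())
Fin3-<-elim _ _ _ _ {2F} {2F} (s≤s (s≤s ()))

antitone⇒<⇔> : ∀ {k m} (g : Fin k → Fin m) → (∀ {x y} → x Fin.< y → g y Fin.< g x) →
               ∀ x y → (g x Fin.< g y) ⇔ (y Fin.< x)
antitone⇒<⇔> g antitone x y = mk⇔ to antitone
  where
  to : g x Fin.< g y → y Fin.< x
  to gx<gy with Finₚ.<-cmp x y
  ... | tri< x<y _ _ = ⊥-elim (Finₚ.<-asym gx<gy (antitone x<y))
  ... | tri≈ _ refl _ = ⊥-elim (Finₚ.<-irrefl refl gx<gy)
  ... | tri> _ _ y<x = y<x

contains321⇒occurrence : ∀ {m} {σ : Permutation′ m} → Contains σ p321 → Occurrence321 σ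
contains321⇒occurrence (f , monotone , ≅321) =
  occurrence (monotone 0F 1F (s≤s z≤n)) (monotone 1F 2F (s≤s (s≤s z≤n)))
             (Equivalence.from (≅321 2F 1F) (s≤s z≤n)) (Equivalence.from (≅321 1F 0F) (s≤s (s≤s z≤n)))

occurrence⇒contains321 : ∀ {m} {σ : Permutation′ m} → Occurrence321 σ → Contains σ p321
occurrence⇒contains321 {m} {σ} (occurrence {i} {j} {k} i<j j<k σk<σj σj<σi) = f , monotone , ≅321
  where
  f : Fin 3 → Fin m
  f 0F = i
  f 1F = j
  f 2F = k
  monotone : ∀ x y → x Fin.< y → f x Fin.< f y
  monotone _ _ = Fin3-<-elim (λ x y → f x Fin.< f y) i<j (<-trans i<j j<k) j<k
  σf-antitone : ∀ {x y} → x Fin.< y → σ ⟨$⟩ʳ f y Fin.< σ ⟨$⟩ʳ f x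
  σf-antitone = Fin3-<-elim (λ x y → σ ⟨$⟩ʳ f y Fin.< σ ⟨$⟩ʳ f x) σj<σi (<-trans σk<σj σj<σi) σk<σj
  p321-antitone : ∀ {x y} → x Fin.< y → p321 ⟨$⟩ʳ y Fin.< p321 ⟨$⟩ʳ x
  p321-antitone = Fin3-<-elim (λ x y → p321 ⟨$⟩ʳ y Fin.< p321 ⟨$⟩ʳ x) (s≤s (s≤s z≤n)) (s≤s z≤n) (s≤s z≤n)
  ≅321 : ∀ x y → (σ ⟨$⟩ʳ f x Fin.< σ ⟨$⟩ʳ f y) ⇔ (p321 ⟨$⟩ʳ x Fin.< p321 ⟨$⟩ʳ y)
  ≅321 x y = ⇔.trans (antitone⇒<⇔> ((σ ⟨$⟩ʳ_) ∘ f) σf-antitone x y)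
                     (⇔.sym (antitone⇒<⇔> (p321 ⟨$⟩ʳ_) p321-antitone x y))

displacement≤1⇒avoids321 : ∀ {m} (π : Permutation′ m) →
  (∀ i → toℕ (π ⟨$⟩ʳ i) ≤ suc (toℕ i)) → (∀ i → toℕ i ≤ suc (toℕ (π ⟨$⟩ʳ i))) → Avoids π p321
displacement≤1⇒avoids321 π up down contains = <-irrefl refl (begin-strict
    suc (toℕ i)              <⟨ n<1+n _ ⟩
    suc (suc (toℕ i))        ≤⟨ ≤-trans (s≤s i<j) j<k ⟩
    toℕ k                    ≤⟨ down k ⟩
    suc (toℕ (π ⟨$⟩ʳ k))     ≤⟨ πk<πj ⟩
    toℕ (π ⟨$⟩ʳ j)           <⟨ πj<πi ⟩
    toℕ (π ⟨$⟩ʳ i)           ≤⟨ up i ⟩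
    suc (toℕ i)              ∎)
  where
  open ≤-Reasoning
  open Occurrence321 (contains321⇒occurrence {σ = π} contains) renaming (σk<σj to πk<πj; σj<σi to πj<πi)

swapPairs-avoids321 : ∀ {m} → Avoids (swapPairsPerm {m}) p321
swapPairs-avoids321 = displacement≤1⇒avoids321 swapPairsPerm toℕ-swapPairs-≤ toℕ-swapPairs-≥

swapPairs-dumont : ∀ n → IsDumont1 n swapPairsPerm
swapPairs-dumont n i with even⊎odd (toℕ i)
... | inj₁ i-even = (λ _ → descent) , λ val-odd → ⊥-elim (even⇒¬odd val-even val-odd)
  where
  swap-i≡1+i : toℕ (swapPairs i) ≡ suc (toℕ i)
  swap-i≡1+i = toℕ-swapPairs-even i i-even (even<double⇒suc<double n i-even (toℕ<n i))
  val-even : IsEven (suc (toℕ (swapPairs i)))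
  val-even = subst (IsEven ∘ suc) (sym swap-i≡1+i) (odd⇒suc-even (even⇒suc-odd i-even))
  descent : ∃ λ j → (toℕ j ≡ suc (toℕ i)) × (swapPairs j Fin.< swapPairs i)
  descent = swapPairs i , swap-i≡1+i ,
    subst (λ j → toℕ j < toℕ (swapPairs i)) (sym (swapPairs-involutive i))
          (≤-reflexive (sym swap-i≡1+i))
... | inj₂ i-odd = (λ val-even → ⊥-elim (even⇒¬odd val-even val-odd)) , λ _ → ascent
  where
  1+swap-i≡i : suc (toℕ (swapPairs i)) ≡ toℕ i
  1+swap-i≡i = toℕ-swapPairs-odd i i-odd
  val-odd : IsOdd (suc (toℕ (swapPairs i)))
  val-odd = subst IsOdd (sym 1+swap-i≡i) i-odd
  ascent : (suc (toℕ i) ≡ n + n) ⊎ ∃ λ j → (toℕ j ≡ suc (toℕ i)) × (swapPairs i Fin.< swapPairs j)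
  ascent with suc (toℕ i) ≟ n + n
  ... | yes last = inj₁ last
  ... | no ¬last = inj₂ (j , toℕ-fromℕ< 1+i<2n , ≤-pred (begin
      suc (suc (toℕ (swapPairs i))) ≡⟨ cong suc 1+swap-i≡i ⟩
      suc (toℕ i)                   ≡⟨ toℕ-fromℕ< 1+i<2n ⟨
      toℕ j                         ≤⟨ toℕ-swapPairs-≥ j ⟩
      suc (toℕ (swapPairs j))       ∎))
    where
    open ≤-Reasoning
    1+i<2n : suc (toℕ i) < n + n
    1+i<2n = ≤∧≢⇒< (toℕ<n i) ¬last
    j : Fin (n + n)
    j = fromℕ< 1+i<2n

module Uniqueness {n} (σ : Permutation′ (n + n)) (dumont : IsDumont1 n σ) (avoids : Avoids σ p321) where

  σ-injective : ∀ {a b} → σ ⟨$⟩ʳ a ≡ σ ⟨$⟩ʳ b → a ≡ b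
  σ-injective = Injection.injective (↔⇒↣ σ)

  σ-values-distinct : ∀ {a b} → toℕ a < toℕ b → toℕ (σ ⟨$⟩ʳ a) ≢ toℕ (σ ⟨$⟩ʳ b)
  σ-values-distinct a<b σa≡σb = <-irrefl (cong toℕ (σ-injective (toℕ-injective σa≡σb))) a<b

  AgreesBelow : ℕ → Set
  AgreesBelow k = ∀ i → toℕ i < k + k → σ ⟨$⟩ʳ i ≡ swapPairs i

  agrees⇒<double : ∀ k {i} → AgreesBelow k → toℕ i < k + k → toℕ (σ ⟨$⟩ʳ i) < k + k
  agrees⇒<double k {i} agree i<2k rewrite agree i i<2k = toℕ-swapPairs-<double k i i<2k

  -- swapPairs maps [0,2k) onto itself, so by injectivity σ maps nothing outside it into it.
  agrees⇒≥double : ∀ k {i} → AgreesBelow k → k + k ≤ toℕ i → k + k ≤ toℕ (σ ⟨$⟩ʳ i)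
  agrees⇒≥double k {i} agree 2k≤i = ≮⇒≥ λ σi<2k → <⇒≱ (σi<2k⇒i<2k σi<2k) 2k≤i
    where
    σi<2k⇒i<2k : toℕ (σ ⟨$⟩ʳ i) < k + k → toℕ i < k + k
    σi<2k⇒i<2k σi<2k = subst (λ j → toℕ j < k + k) swap-σi≡i swap-σi<2k
      where
      swap-σi<2k : toℕ (swapPairs (σ ⟨$⟩ʳ i)) < k + k
      swap-σi<2k = toℕ-swapPairs-<double k (σ ⟨$⟩ʳ i) σi<2k
      swap-σi≡i : swapPairs (σ ⟨$⟩ʳ i) ≡ i
      swap-σi≡i = σ-injective (trans (agree _ swap-σi<2k) (swapPairs-involutive (σ ⟨$⟩ʳ i)))

  module Step {k} (1+k≤n : suc k ≤ n) (agree : AgreesBelow k) where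

    2k<2n : k + k < n + n
    2k<2n = +-mono-< 1+k≤n 1+k≤n

    1+2k<2n : suc (k + k) < n + n
    1+2k<2n = even<double⇒suc<double n (k , refl) 2k<2n

    p : Fin (n + n)
    p = σ ⟨$⟩ˡ fromℕ< 1+2k<2n

    σp≡1+2k : toℕ (σ ⟨$⟩ʳ p) ≡ suc (k + k)
    σp≡1+2k = trans (cong toℕ (inverseʳ σ)) (toℕ-fromℕ< 1+2k<2n)

    2k≤p : k + k ≤ toℕ p
    2k≤p = ≮⇒≥ λ p<2k → <⇒≱ (agrees⇒<double k agree p<2k) (subst (k + k ≤_) (sym σp≡1+2k) (n≤1+n _))

    -- σ p is the 1-based value 2k+2 of Defs.val, which is even.
    descent : ∃ λ j → (toℕ j ≡ suc (toℕ p)) × (σ ⟨$⟩ʳ j Fin.< σ ⟨$⟩ʳ p)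
    descent = proj₁ (dumont p) (subst IsEven (cong suc (sym σp≡1+2k)) (odd⇒suc-even (k , refl)))

    j : Fin (n + n)
    j = proj₁ descent

    j≡1+p : toℕ j ≡ suc (toℕ p)
    j≡1+p = proj₁ (proj₂ descent)

    σj<σp : σ ⟨$⟩ʳ j Fin.< σ ⟨$⟩ʳ p
    σj<σp = proj₂ (proj₂ descent)

    σj≡2k : toℕ (σ ⟨$⟩ʳ j) ≡ k + k
    σj≡2k = ≤-antisym (≤-pred (subst (toℕ (σ ⟨$⟩ʳ j) <_) σp≡1+2k σj<σp))
                      (agrees⇒≥double k agree (subst (k + k ≤_) (sym j≡1+p) (m≤n⇒m≤1+n 2k≤p)))

    2k<p⇒occurrence : k + k < toℕ p → Occurrence321 σ
    2k<p⇒occurrence 2k<p = occurrence a<p p<j σj<σp σp<σa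
      where
      a : Fin (n + n)
      a = fromℕ< 2k<2n
      a≡2k : toℕ a ≡ k + k
      a≡2k = toℕ-fromℕ< 2k<2n
      a<p : toℕ a < toℕ p
      a<p = subst (_< toℕ p) (sym a≡2k) 2k<p
      p<j : toℕ p < toℕ j
      p<j = ≤-reflexive (sym j≡1+p)
      σa≢2k : k + k ≢ toℕ (σ ⟨$⟩ʳ a)
      σa≢2k 2k≡σa = σ-values-distinct (<-trans a<p p<j) (trans (sym 2k≡σa) (sym σj≡2k))
      σa≢1+2k : suc (k + k) ≢ toℕ (σ ⟨$⟩ʳ a)
      σa≢1+2k 1+2k≡σa = σ-values-distinct a<p (trans (sym 1+2k≡σa) (sym σp≡1+2k))
      σp<σa : toℕ (σ ⟨$⟩ʳ p) < toℕ (σ ⟨$⟩ʳ a)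
      σp<σa = subst (_< toℕ (σ ⟨$⟩ʳ a)) (sym σp≡1+2k)
                (≤∧≢⇒< (≤∧≢⇒< (agrees⇒≥double k agree (≤-reflexive (sym a≡2k))) σa≢2k) σa≢1+2k)

    p≡2k : toℕ p ≡ k + k
    p≡2k = sym (≤∧≮⇒≡ 2k≤p (avoids ∘ occurrence⇒contains321 ∘ 2k<p⇒occurrence))

    j≡1+2k : toℕ j ≡ suc (k + k)
    j≡1+2k = trans j≡1+p (cong suc p≡2k)

    agrees-at-2k : ∀ i → toℕ i ≡ k + k → σ ⟨$⟩ʳ i ≡ swapPairs i
    agrees-at-2k i i≡2k = toℕ-injective (begin
      toℕ (σ ⟨$⟩ʳ i)     ≡⟨ cong (toℕ ∘ (σ ⟨$⟩ʳ_)) (toℕ-injective (trans i≡2k (sym p≡2k))) ⟩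
      toℕ (σ ⟨$⟩ʳ p)     ≡⟨ σp≡1+2k ⟩
      suc (k + k)        ≡⟨ cong suc i≡2k ⟨
      suc (toℕ i)        ≡⟨ toℕ-swapPairs-even i (k , i≡2k) 1+i<2n ⟨
      toℕ (swapPairs i)  ∎)
      where
      open ≡-Reasoning
      1+i<2n : suc (toℕ i) < n + n
      1+i<2n = subst (_< n + n) (cong suc (sym i≡2k)) 1+2k<2n

    agrees-at-1+2k : ∀ i → toℕ i ≡ suc (k + k) → σ ⟨$⟩ʳ i ≡ swapPairs i
    agrees-at-1+2k i i≡1+2k = toℕ-injective (begin
      toℕ (σ ⟨$⟩ʳ i)     ≡⟨ cong (toℕ ∘ (σ ⟨$⟩ʳ_)) (toℕ-injective (trans i≡1+2k (sym j≡1+2k))) ⟩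
      toℕ (σ ⟨$⟩ʳ j)     ≡⟨ σj≡2k ⟩
      k + k              ≡⟨ suc-injective (trans (toℕ-swapPairs-odd i (k , i≡1+2k)) i≡1+2k) ⟨
      toℕ (swapPairs i)  ∎)
      where open ≡-Reasoning

    agrees-suc : AgreesBelow (suc k)
    agrees-suc i i<2+2k with <-cmp (toℕ i) (k + k)
    ... | tri< i<2k _ _ = agree i i<2k
    ... | tri≈ _ i≡2k _ = agrees-at-2k i i≡2k
    ... | tri> _ _ 2k<i = agrees-at-1+2k i (≤-antisym i≤1+2k 2k<i)
      where
      i≤1+2k : toℕ i ≤ suc (k + k)
      i≤1+2k = ≤-pred (subst (toℕ i <_) (cong suc (+-suc k k)) i<2+2k)

  agrees : ∀ k → k ≤ n → AgreesBelow k
  agrees zero _ _ ()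
  agrees (suc k) 1+k≤n = Step.agrees-suc 1+k≤n (agrees k (<⇒≤ 1+k≤n))

  σ≡swapPairs : ∀ i → σ ⟨$⟩ʳ i ≡ swapPairs i
  σ≡swapPairs i = agrees n ≤-refl i (toℕ<n i)

theorem2p4 : ∀ (n : ℕ) →
    ∃ λ (π : Permutation′ (n + n)) →
    InD1-321 n π ×
    (∀ (σ : Permutation′ (n + n)) → InD1-321 n σ → ∀ (i : Fin (n + n)) → σ ⟨$⟩ʳ i ≡ π ⟨$⟩ʳ i)
theorem2p4 n = swapPairsPerm , (swapPairs-dumont n , swapPairs-avoids321) ,
  λ σ (dumont , avoids) → Uniqueness.σ≡swapPairs {n = n} σ dumont avoids
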